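{- In the consistent expiration streaming model with $n$ items and error parameter $\varepsilon\in(0,1/2]$, one can maintain, storing $\mathcal{O}(1/\varepsilon)$ words, an estimate $\hat n_{\mathrm{now}}$ of the number $n_{\mathrm{now}}$ of currently active (inserted and not yet expired) items such that $\hat n_{\mathrm{now}}\le n_{\mathrm{now}}\le\hat n_{\mathrm{now}}+\varepsilon n$.
   Context: Expiration streaming model: the stream is a sequence of items $x_1,\dots,x_n$, each with insertion time $S(x_i)$ and expiration time $E(x_i)>S(x_i)$ (possibly $\infty$), with $S(x_1)\le\dots\le S(x_n)$; item $x$ is active at time $t$ iff $S(x)\le t<E(x)$. The stream has consistent expirations if additionally $E(x_1)\le\dots\le E(x_n)$. Space is measured in words, each storing a time value or a counter in $[\mathrm{poly}(n)]$. -}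

module Defs where

open import Data.Nat using (ℕ; zero; suc; _+_; _*_; _^_; _≤_; _<_)
open import Data.Integer using (+_)
open import Data.Rational using (ℚ; _/_)
open import Data.List using (List; []; _∷_; foldl; length; filter)
open import Data.List.Relation.Unary.All using (All)
open import Data.List.Relation.Unary.Any using (Any)
open import Data.List.Relation.Unary.AllPairs using (AllPairs)
open import Data.Product using (_×_)
open import Data.Sum using (_⊎_)
open import Relation.Binary.PropositionalEquality using (_≡_)
open import Relation.Nullary using (Dec; yes; no)
open import Data.Unit using (⊤)
open import Data.Empty using (⊥)

data Time∞ : Set where
  fin : ℕ → Time∞
  ∞   : Time∞

_<∞_ : ℕ → Time∞ → Set
t <∞ fin e = t < e
t <∞ ∞     = ⊤

_≤∞_ : Time∞ → Time∞ → Set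
fin a ≤∞ fin b = a ≤ b
fin a ≤∞ ∞     = ⊤
∞     ≤∞ fin b = ⊥
∞     ≤∞ ∞     = ⊤

record Item : Set where
  constructor item
  field
    S : ℕ
    E : Time∞
open Item public

ConsistentStream : List Item → Set
ConsistentStream xs =
  All (λ x → S x <∞ E x) xs ×
  AllPairs (λ x y → S x ≤ S y) xs ×
  AllPairs (λ x y → E x ≤∞ E y) xs

Active : ℕ → Item → Set
Active t x = S x ≤ t × t <∞ E x

open import Data.Nat using (_≤?_; _<?_)
open import Relation.Nullary.Decidable using (_×-dec_)

active? : (t : ℕ) → (x : Item) → Dec (Active t x)
active? t x = (S x ≤? t) ×-dec lt (E x)
  where
  lt : (e : Time∞) → Dec (t <∞ e)
  lt (fin e) = t <? e
  lt ∞       = yes _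

nNow : ℕ → List Item → ℕ
nNow t xs = length (filter (active? t) xs)

data Word : Set where
  time    : Time∞ → Word
  counter : ℕ → Word

-- A streaming algorithm: initial memory, update on arrival of an item,
-- and a query returning the estimate at the current time t.
record StreamAlg : Set where
  field
    init  : List Word
    step  : List Word → Item → List Word
    query : List Word → ℕ → ℕ
open StreamAlg public

run : StreamAlg → List Item → List Word
run A xs = foldl (step A) (init A) xs

-- Word-model restriction: a time word holds a time value occurring in the
-- stream (some S or E of an item); a counter word holds a value ≤ c·(n+1)^c.
ValidWord : ℕ → List Item → Word → Set
ValidWord c xs (time τ)    = Any (λ x → fin (S x) ≡ τ ⊎ E x ≡ τ) xs
ValidWord c xs (counter k) = k ≤ c * (suc (length xs)) ^ c

ℕtoℚ : ℕ → ℚ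
ℕtoℚ k = + k / 1

{-# OPTIONS --safe #-}

-- The sketch cuts the stream into at most 2k buckets of consecutive items (k ≈ 1/ε), all
-- of a common width w except the newest, and stores for each bucket only its size and the
-- expiration time of its oldest item. When the newest bucket is full and 2k buckets exist,
-- neighbours are merged pairwise and w doubles; the stream then already holds 2k·w items,
-- so k·(w ∸ 1) ≤ n at all times. Since expirations are nondecreasing, a bucket whose oldest
-- item is alive is entirely alive, and once that item has expired every older item has too.
-- Summing the sizes of the buckets with a live oldest item therefore undercounts only
-- within a single bucket, by at most w ∸ 1 ≤ εn. The memory is one word for w and two per
-- bucket, i.e. O(k) = O(1/ε) words.

module Submission where

import Data.Integer as ℤ
import Data.Integer.Properties as ℤ
open import Data.Integer using (+_)
open import Data.List using (List; []; _∷_; _++_; [_]; length; map; foldl; filter)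
open import Data.List.Properties
  using ( length-++; length-++-≤ˡ; length-map; ++-assoc; ++-identityʳ
        ; filter-++; filter-all; filter-none; filter-reject; length-filter)
open import Data.List.Membership.Propositional using (_∈_)
open import Data.List.Membership.Propositional.Properties using (∈-++⁺ˡ; ∈-++⁺ʳ)
open import Data.List.NonEmpty as List⁺ using (List⁺; _∷_; head; tail; toList; _⁺∷ʳ_; _⁺++⁺_)
open import Data.List.NonEmpty.Properties using (length-⁺++⁺)
open import Data.List.Relation.Unary.All as All using (All; []; _∷_)
import Data.List.Relation.Unary.All.Properties as All
open import Data.List.Relation.Unary.Any as Any using (here)
open import Data.List.Relation.Unary.AllPairs using (AllPairs; []; _∷_)
open import Data.Nat
open import Data.Nat.Properties
open import Data.Nat.Coprimality using (Coprime; 1-coprimeTo) renaming (sym to coprime-sym)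
open import Data.Nat.DivMod using (m≡m%n+[m/n]*n; m%n<n; m/n*n≤m)
open import Data.Nat.Tactic.RingSolver using (solve-∀)
open import Data.Product using (Σ; _×_; _,_; proj₁; proj₂)
open import Data.Rational using (ℚ; mkℚ; 0ℚ; ½)
import Data.Rational as ℚ
import Data.Rational.Properties as ℚ
open import Data.Rational.Unnormalised using (mkℚᵘ)
import Data.Rational.Unnormalised as ℚᵘ
import Data.Rational.Unnormalised.Properties as ℚᵘ
open import Data.Sum using (inj₂)
open import Data.Unit using (⊤; tt)
open import Function using (_∘_)
open import Relation.Binary.PropositionalEquality
  using (_≡_; _≢_; refl; sym; trans; cong; cong₂; subst; subst₂; module ≡-Reasoning)
open import Relation.Nullary using (Dec; yes; no; ¬_; contradiction)

open import Defs

private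
  variable
    A : Set

toℚᵘ-ℕtoℚ : ∀ m → ℚ.toℚᵘ (ℕtoℚ m) ≡ mkℚᵘ (+ m) 0
toℚᵘ-ℕtoℚ m = cong ℚ.toℚᵘ (ℚ.normalize-coprime (coprime-sym (1-coprimeTo m)))

mkℚᵘ-mono-≤ : ∀ {a b-1 c d-1} → a * suc d-1 ≤ c * suc b-1 → mkℚᵘ (+ a) b-1 ℚᵘ.≤ mkℚᵘ (+ c) d-1
mkℚᵘ-mono-≤ {a} {_} {c} h = ℚᵘ.*≤* (subst₂ ℤ._≤_ (ℤ.pos-* a _) (ℤ.pos-* c _) (ℤ.+≤+ h))

ℕtoℚ-mono-≤ : ∀ {a b} → a ≤ b → ℕtoℚ a ℚ.≤ ℕtoℚ b
ℕtoℚ-mono-≤ {a} {b} a≤b = ℚ.toℚᵘ-cancel-≤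
  (subst₂ ℚᵘ._≤_ (sym (toℚᵘ-ℕtoℚ a)) (sym (toℚᵘ-ℕtoℚ b)) (mkℚᵘ-mono-≤ (*-monoˡ-≤ 1 a≤b)))

ℕtoℚ-homo-+ : ∀ a b → ℕtoℚ (a + b) ≡ ℕtoℚ a ℚ.+ ℕtoℚ b
ℕtoℚ-homo-+ a b = ℚ.toℚᵘ-injective (begin
  ℚ.toℚᵘ (ℕtoℚ (a + b))                ≡⟨ toℚᵘ-ℕtoℚ (a + b) ⟩
  mkℚᵘ (+ (a + b)) 0                   ≈⟨ ℚᵘ.*≡* (cong (ℤ._* + 1) sum-nf) ⟩
  mkℚᵘ (+ a) 0 ℚᵘ.+ mkℚᵘ (+ b) 0       ≡⟨ sym (cong₂ ℚᵘ._+_ (toℚᵘ-ℕtoℚ a) (toℚᵘ-ℕtoℚ b)) ⟩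
  ℚ.toℚᵘ (ℕtoℚ a) ℚᵘ.+ ℚ.toℚᵘ (ℕtoℚ b) ≈⟨ ℚᵘ.≃-sym (ℚ.toℚᵘ-homo-+ (ℕtoℚ a) (ℕtoℚ b)) ⟩
  ℚ.toℚᵘ (ℕtoℚ a ℚ.+ ℕtoℚ b)           ∎)
  where
  open ℚᵘ.≃-Reasoning
  sum-nf : + (a + b) ≡ + a ℤ.* + 1 ℤ.+ + b ℤ.* + 1
  sum-nf = trans (ℤ.pos-+ a b) (sym (cong₂ ℤ._+_ (ℤ.*-identityʳ (+ a)) (ℤ.*-identityʳ (+ b))))

module Fraction (p d-1 : ℕ) .(coprime : Coprime p (suc d-1)) where

  frac : ℚ
  frac = mkℚ (+ p) d-1 coprime

  toℚᵘ-frac-*-ℕtoℚ : ∀ m → ℚ.toℚᵘ (frac ℚ.* ℕtoℚ m) ℚᵘ.≃ mkℚᵘ (+ (p * m)) d-1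
  toℚᵘ-frac-*-ℕtoℚ m = begin
    ℚ.toℚᵘ (frac ℚ.* ℕtoℚ m)            ≈⟨ ℚ.toℚᵘ-homo-* frac (ℕtoℚ m) ⟩
    mkℚᵘ (+ p) d-1 ℚᵘ.* ℚ.toℚᵘ (ℕtoℚ m) ≡⟨ cong (mkℚᵘ (+ p) d-1 ℚᵘ.*_) (toℚᵘ-ℕtoℚ m) ⟩
    mkℚᵘ (+ p) d-1 ℚᵘ.* mkℚᵘ (+ m) 0    ≈⟨ ℚᵘ.*≡* (cong₂ ℤ._*_ (sym (ℤ.pos-* p m)) denominator) ⟩
    mkℚᵘ (+ (p * m)) d-1                ∎
    where
    open ℚᵘ.≃-Reasoning
    denominator : + suc d-1 ≡ + suc (d-1 * 1)
    denominator = cong (λ n → + suc n) (sym (*-identityʳ d-1))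

  frac-*-ℕtoℚ-≤ : ∀ m a → p * m ≤ a * suc d-1 → frac ℚ.* ℕtoℚ m ℚ.≤ ℕtoℚ a
  frac-*-ℕtoℚ-≤ m a pm≤aq = ℚ.toℚᵘ-cancel-≤ (begin
    ℚ.toℚᵘ (frac ℚ.* ℕtoℚ m) ≃⟨ toℚᵘ-frac-*-ℕtoℚ m ⟩
    mkℚᵘ (+ (p * m)) d-1     ≤⟨ mkℚᵘ-mono-≤ (≤-trans (≤-reflexive (*-identityʳ (p * m))) pm≤aq) ⟩
    mkℚᵘ (+ a) 0             ≡⟨ toℚᵘ-ℕtoℚ a ⟨
    ℚ.toℚᵘ (ℕtoℚ a)          ∎)
    where open ℚᵘ.≤-Reasoning

  ℕtoℚ-≤-frac-* : ∀ m a → a * suc d-1 ≤ p * m → ℕtoℚ a ℚ.≤ frac ℚ.* ℕtoℚ m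
  ℕtoℚ-≤-frac-* m a aq≤pm = ℚ.toℚᵘ-cancel-≤ (begin
    ℚ.toℚᵘ (ℕtoℚ a)          ≡⟨ toℚᵘ-ℕtoℚ a ⟩
    mkℚᵘ (+ a) 0             ≤⟨ mkℚᵘ-mono-≤ (≤-trans aq≤pm (≤-reflexive (sym (*-identityʳ (p * m))))) ⟩
    mkℚᵘ (+ (p * m)) d-1     ≃⟨ toℚᵘ-frac-*-ℕtoℚ m ⟨
    ℚ.toℚᵘ (frac ℚ.* ℕtoℚ m) ∎)
    where open ℚᵘ.≤-Reasoning

  ℕtoℚ-≤-+-frac-* : ∀ a b e n → a ≤ b + e → e * suc d-1 ≤ p * n →
                    ℕtoℚ a ℚ.≤ ℕtoℚ b ℚ.+ frac ℚ.* ℕtoℚ n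
  ℕtoℚ-≤-+-frac-* a b e n a≤b+e e≤εn = begin
    ℕtoℚ a                      ≤⟨ ℕtoℚ-mono-≤ a≤b+e ⟩
    ℕtoℚ (b + e)                ≡⟨ ℕtoℚ-homo-+ b e ⟩
    ℕtoℚ b ℚ.+ ℕtoℚ e           ≤⟨ ℚ.+-monoʳ-≤ (ℕtoℚ b) (ℕtoℚ-≤-frac-* n e e≤εn) ⟩
    ℕtoℚ b ℚ.+ frac ℚ.* ℕtoℚ n  ∎
    where open ℚ.≤-Reasoning

  frac-≤-½ : frac ℚ.≤ ½ → p * 2 ≤ suc d-1
  frac-≤-½ (ℚ.*≤* h) = subst (p * 2 ≤_) (*-identityˡ (suc d-1))
    (ℤ.drop‿+≤+ (subst₂ ℤ._≤_ (sym (ℤ.pos-* p 2)) (sym (ℤ.pos-* 1 (suc d-1))) h))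

_<∞?_ : (t : ℕ) (e : Time∞) → Dec (t <∞ e)
t <∞? fin e = t <? e
t <∞? ∞     = yes tt

<∞-≤∞-trans : ∀ {t} e e′ → t <∞ e → e ≤∞ e′ → t <∞ e′
<∞-≤∞-trans (fin e) (fin e′) t<e e≤e′ = <-≤-trans t<e e≤e′
<∞-≤∞-trans (fin e) ∞        _   _    = tt
<∞-≤∞-trans ∞       (fin e′) _   ()
<∞-≤∞-trans ∞       ∞        _   _    = tt

ExpirySorted : List Item → Set
ExpirySorted = AllPairs (λ x y → E x ≤∞ E y)

AllPairs-++⁻ : ∀ {R : A → A → Set} xs ys → AllPairs R (xs ++ ys) →
               AllPairs R xs × AllPairs R ys × All (λ x → All (R x) ys) xs
AllPairs-++⁻ []       ys h          = [] , h , []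
AllPairs-++⁻ (x ∷ xs) ys (Rx ∷ h) with AllPairs-++⁻ xs ys h
... | sorted-xs , sorted-ys , across = All.++⁻ˡ xs Rx ∷ sorted-xs , sorted-ys , All.++⁻ʳ xs Rx ∷ across

nNow-++ : ∀ t xs ys → nNow t (xs ++ ys) ≡ nNow t xs + nNow t ys
nNow-++ t xs ys = trans (cong length (filter-++ (active? t) xs ys)) (length-++ (filter (active? t) xs))

nNow-all : ∀ {t xs} → All (Active t) xs → nNow t xs ≡ length xs
nNow-all {t} all-active = cong length (filter-all (active? t) all-active)

nNow-none : ∀ {t xs} → All (¬_ ∘ Active t) xs → nNow t xs ≡ 0
nNow-none {t} none-active = cong length (filter-none (active? t) none-active)

nNow-inactive-∷ : ∀ {t} x xs → ¬ Active t x → nNow t (x ∷ xs) ≤ length xs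
nNow-inactive-∷ {t} x xs inactive =
  ≤-trans (≤-reflexive (cong length (filter-reject (active? t) {x} {xs} inactive))) (length-filter (active? t) xs)

unexpired-all-active : ∀ {t y} ys → t <∞ E y → All (λ z → E y ≤∞ E z) ys →
                       All (λ z → S z ≤ t) (y ∷ ys) → All (Active t) (y ∷ ys)
unexpired-all-active {t} {y} ys t<Ey Ey≤ (Sy≤t ∷ S≤t) = (Sy≤t , t<Ey) ∷ All.zipWith later (Ey≤ , S≤t)
  where
  later : ∀ {z} → E y ≤∞ E z × S z ≤ t → Active t z
  later {z} (Ey≤Ez , Sz≤t) = Sz≤t , <∞-≤∞-trans (E y) (E z) t<Ey Ey≤Ez

expired-none-active : ∀ {t y xs} → ¬ t <∞ E y → All (λ x → E x ≤∞ E y) xs → All (¬_ ∘ Active t) xs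
expired-none-active {t} {y} t≮Ey =
  All.map (λ {x} Ex≤Ey active → t≮Ey (<∞-≤∞-trans (E x) (E y) (proj₂ active) Ex≤Ey))

-- A bucket holds the number of consecutive items it stands for and the expiration time
-- of the oldest of them; buckets are listed newest first.
Bucket : Set
Bucket = ℕ × Time∞

record Sketch : Set where
  constructor sketch
  field
    width   : ℕ
    buckets : List Bucket
open Sketch

emptySketch : Sketch
emptySketch = sketch 1 []

pairUp : List Bucket → List Bucket
pairUp []                          = []
pairUp (b ∷ [])                    = b ∷ []
pairUp ((s , _) ∷ (s′ , e′) ∷ bs) = (s′ + s , e′) ∷ pairUp bs

insert : ℕ → Sketch → Item → Sketch
insert k (sketch w []) x = sketch w [ 1 , E x ]
insert k (sketch w ((s , e) ∷ bs)) x with s ≟ w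
... | no _ = sketch w ((suc s , e) ∷ bs)
... | yes _ with k + k ≤? suc (length bs)
...   | no _  = sketch w ((1 , E x) ∷ (s , e) ∷ bs)
...   | yes _ = sketch (w + w) ((1 , E x) ∷ pairUp ((s , e) ∷ bs))

estimate : ℕ → List Bucket → ℕ
estimate t []             = 0
estimate t ((s , e) ∷ bs) with t <∞? e
... | yes _ = s + estimate t bs
... | no  _ = estimate t bs

-- Groups of items mirror the buckets: groups newest first, items in a group oldest first.
flatten : List (List⁺ A) → List A
flatten []      = []
flatten (g ∷ G) = flatten G ++ toList g

summary : List⁺ Item → Bucket
summary g = List⁺.length g , E (head g)

mergePairs : List (List⁺ A) → List (List⁺ A)
mergePairs []           = []
mergePairs (g ∷ [])     = g ∷ []
mergePairs (g ∷ g′ ∷ G) = (g′ ⁺++⁺ g) ∷ mergePairs G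

flatten-mergePairs : ∀ (G : List (List⁺ A)) → flatten (mergePairs G) ≡ flatten G
flatten-mergePairs []           = refl
flatten-mergePairs (g ∷ [])     = refl
flatten-mergePairs (g ∷ g′ ∷ G) = begin
  flatten (mergePairs G) ++ (toList g′ ++ toList g) ≡⟨ cong (_++ (toList g′ ++ toList g)) (flatten-mergePairs G) ⟩
  flatten G ++ (toList g′ ++ toList g)              ≡⟨ ++-assoc (flatten G) (toList g′) (toList g) ⟨
  (flatten G ++ toList g′) ++ toList g              ∎
  where open ≡-Reasoning

pairUp-summary : ∀ G → pairUp (map summary G) ≡ map summary (mergePairs G)
pairUp-summary []           = refl
pairUp-summary (g ∷ [])     = refl
pairUp-summary (g ∷ g′ ∷ G) =
  cong₂ _∷_ (cong (_, E (head g′)) (sym (length-⁺++⁺ g′ g))) (pairUp-summary G)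

length-⁺∷ʳ : ∀ (g : List⁺ A) x → List⁺.length (g ⁺∷ʳ x) ≡ suc (List⁺.length g)
length-⁺∷ʳ g x = cong suc (trans (length-++ (tail g)) (+-comm (length (tail g)) 1))

heads-∈-flatten : ∀ (G : List (List⁺ A)) → All (λ g → head g ∈ flatten G) G
heads-∈-flatten []      = []
heads-∈-flatten (g ∷ G) = ∈-++⁺ʳ (flatten G) (here refl) ∷ All.map ∈-++⁺ˡ (heads-∈-flatten G)

length-flatten-uniform : ∀ {w} (G : List (List⁺ A)) → All (λ g → List⁺.length g ≡ w) G →
                         length (flatten G) ≡ length G * w
length-flatten-uniform []      []          = refl
length-flatten-uniform {w = w} (g ∷ G) (g≡w ∷ G≡w) = begin
  length (flatten G ++ toList g)       ≡⟨ length-++ (flatten G) ⟩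
  length (flatten G) + List⁺.length g  ≡⟨ cong₂ _+_ (length-flatten-uniform G G≡w) g≡w ⟩
  length G * w + w                     ≡⟨ +-comm (length G * w) w ⟩
  w + length G * w                     ∎
  where open ≡-Reasoning

2+n≡[1+m]+[1+m]⇒n≡m+m : ∀ {n} m → 2 + n ≡ suc m + suc m → n ≡ m + m
2+n≡[1+m]+[1+m]⇒n≡m+m m eq = suc-injective (trans (suc-injective eq) (+-suc m m))

[1+m]+[1+m]≢1 : ∀ m → suc m + suc m ≢ 1
[1+m]+[1+m]≢1 m eq = 0≢1+n (trans (sym (suc-injective eq)) (+-suc m m))

length-mergePairs : ∀ m (G : List (List⁺ A)) → length G ≡ m + m → length (mergePairs G) ≡ m
length-mergePairs zero    []           _  = refl
length-mergePairs (suc m) (g ∷ g′ ∷ G) eq = cong suc (length-mergePairs m G (2+n≡[1+m]+[1+m]⇒n≡m+m m eq))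
length-mergePairs (suc m) (g ∷ [])     eq = contradiction (sym eq) ([1+m]+[1+m]≢1 m)

mergePairs-uniform : ∀ {w} m (G : List (List⁺ A)) → length G ≡ m + m → All (λ g → List⁺.length g ≡ w) G →
                     All (λ g → List⁺.length g ≡ w + w) (mergePairs G)
mergePairs-uniform zero    []           _  []                   = []
mergePairs-uniform (suc m) (g ∷ g′ ∷ G) eq (g≡w ∷ g′≡w ∷ G≡w) =
  trans (length-⁺++⁺ g′ g) (cong₂ _+_ g′≡w g≡w) ∷
  mergePairs-uniform m G (2+n≡[1+m]+[1+m]⇒n≡m+m m eq) G≡w
mergePairs-uniform (suc m) (g ∷ [])     eq _ = contradiction (sym eq) ([1+m]+[1+m]≢1 m)

WellShaped : ℕ → List (List⁺ Item) → Set
WellShaped w []      = ⊤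
WellShaped w (g ∷ G) = List⁺.length g ≤ w × All (λ h → List⁺.length h ≡ w) G

WellShaped⇒≤ : ∀ {w} G → WellShaped w G → All (λ g → List⁺.length g ≤ w) G
WellShaped⇒≤ []      _            = []
WellShaped⇒≤ (g ∷ G) (g≤w , G≡w) = g≤w ∷ All.map ≤-reflexive G≡w

record Represents (k : ℕ) (σ : Sketch) (xs : List Item) : Set where
  constructor represents
  field
    groups       : List (List⁺ Item)
    xs≡flatten   : xs ≡ flatten groups
    buckets≡     : buckets σ ≡ map summary groups
    wellShaped   : WellShaped (width σ) groups
    width-pos    : 1 ≤ width σ
    width-bound  : k * (width σ ∸ 1) ≤ length xs
    groups-bound : length groups ≤ k + k

emptySketch-represents : ∀ k → Represents k emptySketch []
emptySketch-represents k = represents [] refl refl tt ≤-refl (≤-reflexive (*-zeroʳ k)) z≤n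

merge-represents : ∀ {k w} x g G → 1 ≤ k → 1 ≤ w →
                   List⁺.length g ≡ w → All (λ h → List⁺.length h ≡ w) G → length (g ∷ G) ≡ k + k →
                   Represents k (sketch (w + w) ((1 , E x) ∷ pairUp (map summary (g ∷ G)))) (flatten (g ∷ G) ++ [ x ])
merge-represents {k} {w} x g G k≥1 w≥1 g≡w G≡w full =
  represents (List⁺.[ x ] ∷ mergePairs (g ∷ G))
    (cong (_++ [ x ]) (sym (flatten-mergePairs (g ∷ G))))
    (cong ((1 , E x) ∷_) (pairUp-summary (g ∷ G)))
    (w+w≥1 , mergePairs-uniform k (g ∷ G) full (g≡w ∷ G≡w))
    w+w≥1
    width-bound
    (subst (λ n → suc n ≤ k + k) (sym (length-mergePairs k (g ∷ G) full)) (+-monoˡ-≤ k k≥1))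
  where
  w+w≥1 : 1 ≤ w + w
  w+w≥1 = ≤-trans w≥1 (m≤m+n w w)
  width-bound : k * (w + w ∸ 1) ≤ length (flatten (g ∷ G) ++ [ x ])
  width-bound = begin
    k * (w + w ∸ 1)           ≤⟨ *-monoʳ-≤ k (m∸n≤m (w + w) 1) ⟩
    k * (w + w)               ≡⟨ trans (*-distribˡ-+ k w w) (sym (*-distribʳ-+ w k k)) ⟩
    (k + k) * w               ≡⟨ cong (_* w) full ⟨
    length (g ∷ G) * w        ≡⟨ length-flatten-uniform (g ∷ G) (g≡w ∷ G≡w) ⟨
    length (flatten (g ∷ G))  ≤⟨ length-++-≤ˡ (flatten (g ∷ G)) ⟩
    length (flatten (g ∷ G) ++ [ x ]) ∎
    where open ≤-Reasoning

insert-represents : ∀ {k σ xs} x → 1 ≤ k → Represents k σ xs → Represents k (insert k σ x) (xs ++ [ x ])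
insert-represents {k} {sketch w _} x k≥1 (represents [] refl refl _ w≥1 bound _) =
  represents (List⁺.[ x ] ∷ []) refl refl (w≥1 , []) w≥1 (≤-trans bound z≤n) (≤-trans k≥1 (m≤m+n k k))
insert-represents {k} {sketch w _} x k≥1 (represents (g ∷ G) refl refl (g≤w , G≡w) w≥1 bound few)
  with List⁺.length g ≟ w
... | no g≢w =
  represents ((g ⁺∷ʳ x) ∷ G) (++-assoc (flatten G) (toList g) [ x ])
    (cong (λ n → (n , E (head g)) ∷ map summary G) (sym (length-⁺∷ʳ g x)))
    (subst (_≤ w) (sym (length-⁺∷ʳ g x)) (≤∧≢⇒< g≤w g≢w) , G≡w) w≥1
    (≤-trans bound (length-++-≤ˡ (flatten (g ∷ G)))) few
... | yes g≡w with k + k ≤? suc (length (map summary G))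
...   | no budget-left =
  represents (List⁺.[ x ] ∷ g ∷ G) refl refl (w≥1 , g≡w ∷ G≡w) w≥1
    (≤-trans bound (length-++-≤ˡ (flatten (g ∷ G))))
    (subst (λ n → 2 + n ≤ k + k) (length-map summary G) (≰⇒> budget-left))
...   | yes budget-full =
  merge-represents x g G k≥1 w≥1 g≡w G≡w
    (≤-antisym few (subst (λ n → k + k ≤ suc n) (length-map summary G) budget-full))

foldl-insert-represents : ∀ {k} → 1 ≤ k → ∀ ys {σ xs} → Represents k σ xs →
                          Represents k (foldl (insert k) σ ys) (xs ++ ys)
foldl-insert-represents k≥1 []       {σ} {xs} R = subst (Represents _ σ) (sym (++-identityʳ xs)) R
foldl-insert-represents k≥1 (y ∷ ys) {xs = xs} R =
  subst (Represents _ _) (++-assoc xs [ y ] ys) (foldl-insert-represents k≥1 ys (insert-represents y k≥1 R))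

flatten-∷-sorted : ∀ g G → ExpirySorted (flatten (g ∷ G)) →
                   ExpirySorted (flatten G) × All (λ z → E (head g) ≤∞ E z) (tail g) ×
                   All (λ x → E x ≤∞ E (head g)) (flatten G)
flatten-∷-sorted g G sorted with AllPairs-++⁻ (flatten G) (toList g) sorted
... | sorted-G , (head≤tail ∷ _) , across = sorted-G , head≤tail , All.map All.head across

estimate-≤-nNow : ∀ {t} G → ExpirySorted (flatten G) → All (λ x → S x ≤ t) (flatten G) →
                  estimate t (map summary G) ≤ nNow t (flatten G)
estimate-≤-nNow []      _      _       = z≤n
estimate-≤-nNow {t} (g ∷ G) sorted started
  with flatten-∷-sorted g G sorted | All.++⁻ (flatten G) started | t <∞? E (head g)
... | sorted-G , head≤tail , _ | started-G , started-g | yes t<Eg = begin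
  List⁺.length g + estimate t (map summary G) ≤⟨ +-monoʳ-≤ (List⁺.length g) older ⟩
  List⁺.length g + nNow t (flatten G)         ≡⟨ +-comm (List⁺.length g) (nNow t (flatten G)) ⟩
  nNow t (flatten G) + List⁺.length g         ≡⟨ cong (_+_ (nNow t (flatten G))) g-active ⟨
  nNow t (flatten G) + nNow t (toList g)      ≡⟨ nNow-++ t (flatten G) (toList g) ⟨
  nNow t (flatten (g ∷ G))                    ∎
  where
  open ≤-Reasoning
  older : estimate t (map summary G) ≤ nNow t (flatten G)
  older = estimate-≤-nNow G sorted-G started-G
  g-active : nNow t (toList g) ≡ List⁺.length g
  g-active = nNow-all (unexpired-all-active (tail g) t<Eg head≤tail started-g)
... | sorted-G , _ , _ | started-G , _ | no _ = begin
  estimate t (map summary G)             ≤⟨ estimate-≤-nNow G sorted-G started-G ⟩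
  nNow t (flatten G)                     ≤⟨ m≤m+n (nNow t (flatten G)) (nNow t (toList g)) ⟩
  nNow t (flatten G) + nNow t (toList g) ≡⟨ nNow-++ t (flatten G) (toList g) ⟨
  nNow t (flatten (g ∷ G))               ∎
  where open ≤-Reasoning

nNow-≤-estimate : ∀ {t w} G → All (λ g → List⁺.length g ≤ w) G → ExpirySorted (flatten G) →
                  All (λ x → S x ≤ t) (flatten G) → nNow t (flatten G) ≤ estimate t (map summary G) + (w ∸ 1)
nNow-≤-estimate []      _ _      _       = z≤n
nNow-≤-estimate {t} {w} (g ∷ G) (g≤w ∷ G≤w) sorted started
  with flatten-∷-sorted g G sorted | All.++⁻ (flatten G) started | t <∞? E (head g)
... | sorted-G , head≤tail , _ | started-G , started-g | yes t<Eg = begin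
  nNow t (flatten (g ∷ G))               ≡⟨ nNow-++ t (flatten G) (toList g) ⟩
  nNow t (flatten G) + nNow t (toList g) ≡⟨ cong (_+_ (nNow t (flatten G))) g-active ⟩
  nNow t (flatten G) + List⁺.length g    ≤⟨ +-monoˡ-≤ (List⁺.length g) older ⟩
  est + (w ∸ 1) + List⁺.length g         ≡⟨ +-comm (est + (w ∸ 1)) (List⁺.length g) ⟩
  List⁺.length g + (est + (w ∸ 1))       ≡⟨ +-assoc (List⁺.length g) est (w ∸ 1) ⟨
  List⁺.length g + est + (w ∸ 1)         ∎
  where
  open ≤-Reasoning
  est : ℕ
  est = estimate t (map summary G)
  older : nNow t (flatten G) ≤ est + (w ∸ 1)
  older = nNow-≤-estimate G G≤w sorted-G started-G
  g-active : nNow t (toList g) ≡ List⁺.length g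
  g-active = nNow-all (unexpired-all-active (tail g) t<Eg head≤tail started-g)
... | _ , _ , older≤head | _ | no t≮Eg = begin
  nNow t (flatten (g ∷ G))               ≡⟨ nNow-++ t (flatten G) (toList g) ⟩
  nNow t (flatten G) + nNow t (toList g) ≡⟨ cong (_+ nNow t (toList g)) older-expired ⟩
  nNow t (toList g)                      ≤⟨ nNow-inactive-∷ (head g) (tail g) (t≮Eg ∘ proj₂) ⟩
  List⁺.length g ∸ 1                     ≤⟨ ∸-monoˡ-≤ 1 g≤w ⟩
  w ∸ 1                                  ≤⟨ m≤n+m (w ∸ 1) (estimate t (map summary G)) ⟩
  estimate t (map summary G) + (w ∸ 1)   ∎
  where
  open ≤-Reasoning
  older-expired : nNow t (flatten G) ≡ 0
  older-expired = nNow-none (expired-none-active {y = head g} t≮Eg older≤head)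

record WordEncoding (State : Set) : Set where
  field
    encode        : State → List Word
    decode        : List Word → State
    decode-encode : ∀ σ → decode (encode σ) ≡ σ

module _ {State : Set} (encoding : WordEncoding State) where
  open WordEncoding encoding

  wordAlgorithm : State → (State → Item → State) → (State → ℕ → ℕ) → StreamAlg
  wordAlgorithm σ₀ step′ query′ = record
    { init  = encode σ₀
    ; step  = λ ws x → encode (step′ (decode ws) x)
    ; query = query′ ∘ decode
    }

  run-wordAlgorithm : ∀ σ₀ step′ query′ xs →
                      run (wordAlgorithm σ₀ step′ query′) xs ≡ encode (foldl step′ σ₀ xs)
  run-wordAlgorithm σ₀ step′ query′ []       = refl
  run-wordAlgorithm σ₀ step′ query′ (x ∷ xs) =
    trans (cong (λ σ → run (wordAlgorithm (step′ σ x) step′ query′) xs) (decode-encode σ₀))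
          (run-wordAlgorithm (step′ σ₀ x) step′ query′ xs)

  query-wordAlgorithm : ∀ σ₀ step′ query′ σ t →
                        query (wordAlgorithm σ₀ step′ query′) (encode σ) t ≡ query′ σ t
  query-wordAlgorithm σ₀ step′ query′ σ t = cong (λ τ → query′ τ t) (decode-encode σ)

encodeBuckets : List Bucket → List Word
encodeBuckets []             = []
encodeBuckets ((s , e) ∷ bs) = counter s ∷ time e ∷ encodeBuckets bs

decodeBuckets : List Word → List Bucket
decodeBuckets (counter s ∷ time e ∷ ws) = (s , e) ∷ decodeBuckets ws
decodeBuckets _                         = []

decodeBuckets-encodeBuckets : ∀ bs → decodeBuckets (encodeBuckets bs) ≡ bs
decodeBuckets-encodeBuckets []             = refl
decodeBuckets-encodeBuckets ((s , e) ∷ bs) = cong ((s , e) ∷_) (decodeBuckets-encodeBuckets bs)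

length-encodeBuckets : ∀ bs → length (encodeBuckets bs) ≡ length bs + length bs
length-encodeBuckets []       = refl
length-encodeBuckets (_ ∷ bs) = cong suc (trans (cong suc (length-encodeBuckets bs)) (sym (+-suc (length bs) (length bs))))

encodeSketch : Sketch → List Word
encodeSketch σ = counter (width σ) ∷ encodeBuckets (buckets σ)

decodeSketch : List Word → Sketch
decodeSketch (counter w ∷ ws) = sketch w (decodeBuckets ws)
decodeSketch _                = emptySketch

sketchEncoding : WordEncoding Sketch
sketchEncoding = record
  { encode        = encodeSketch
  ; decode        = decodeSketch
  ; decode-encode = λ σ → cong (sketch (width σ)) (decodeBuckets-encodeBuckets (buckets σ))
  }

-- For ε = p/q this is k = ⌊q/p⌋ + 1, so that k·ε ≥ 1; the value at ε ≤ 0 is irrelevant.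
bucketBudget : ℚ → ℕ
bucketBudget (mkℚ (+ suc p-1) d-1 _) = suc (suc d-1 / suc p-1)
bucketBudget _                       = 1

estimateActive : Sketch → ℕ → ℕ
estimateActive σ t = estimate t (buckets σ)

expirationCounter : ℚ → StreamAlg
expirationCounter ε = wordAlgorithm sketchEncoding emptySketch (insert (bucketBudget ε)) estimateActive

counter-valid : ∀ xs {a} → a ≤ suc (length xs) → ValidWord 1 xs (counter a)
counter-valid xs {a} a≤ = subst (a ≤_) (sym (trans (*-identityˡ _) (^-identityʳ (suc (length xs))))) a≤

time-valid : ∀ {c x xs} → x ∈ xs → ValidWord c xs (time (E x))
time-valid = Any.map (λ x≡y → inj₂ (cong E (sym x≡y)))

encodeBuckets-valid : ∀ {c xs} bs →
                      All (λ b → ValidWord c xs (counter (proj₁ b)) × ValidWord c xs (time (proj₂ b))) bs →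
                      All (ValidWord c xs) (encodeBuckets bs)
encodeBuckets-valid []       []                = []
encodeBuckets-valid (_ ∷ bs) ((vs , ve) ∷ vbs) = vs ∷ ve ∷ encodeBuckets-valid bs vbs

width-≤ : ∀ {k w n} → 1 ≤ k → k * (w ∸ 1) ≤ n → w ≤ suc n
width-≤ {k} {w} {n} k≥1 bound =
  ≤-trans (m≤n+m∸n w 1) (s≤s (≤-trans (m≤n*m (w ∸ 1) k {{>-nonZero k≥1}}) bound))

encodeSketch-valid : ∀ {k σ xs} → 1 ≤ k → Represents k σ xs → All (ValidWord 1 xs) (encodeSketch σ)
encodeSketch-valid {σ = sketch w _} k≥1 (represents G refl refl shaped _ bound _) =
  counter-valid (flatten G) w≤n+1 ∷ encodeBuckets-valid (map summary G)
    (All.map⁺ (All.zipWith (λ {g} → bucket-valid g) (WellShaped⇒≤ G shaped , heads-∈-flatten G)))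
  where
  w≤n+1 : w ≤ suc (length (flatten G))
  w≤n+1 = width-≤ k≥1 bound
  bucket-valid : ∀ g → List⁺.length g ≤ w × head g ∈ flatten G →
                 ValidWord 1 (flatten G) (counter (List⁺.length g)) × ValidWord 1 (flatten G) (time (E (head g)))
  bucket-valid g (g≤w , g∈) = counter-valid (flatten G) (≤-trans g≤w w≤n+1) , time-valid {c = 1} g∈

length-encodeSketch : ∀ {k σ xs} → Represents k σ xs → length (encodeSketch σ) ≤ suc ((k + k) + (k + k))
length-encodeSketch {k} {sketch _ _} (represents G _ refl _ _ _ few) = begin
  suc (length (encodeBuckets (map summary G)))    ≡⟨ cong suc (length-encodeBuckets (map summary G)) ⟩
  suc (length (map summary G) + length (map summary G)) ≡⟨ cong (λ n → suc (n + n)) (length-map summary G) ⟩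
  suc (length G + length G)                       ≤⟨ s≤s (+-mono-≤ few few) ⟩
  suc ((k + k) + (k + k))                         ∎
  where open ≤-Reasoning

estimate-accurate : ∀ {k σ xs t} → Represents k σ xs → ConsistentStream xs → All (λ x → S x ≤ t) xs →
                    estimate t (buckets σ) ≤ nNow t xs × nNow t xs ≤ estimate t (buckets σ) + (width σ ∸ 1)
estimate-accurate {σ = sketch _ _} (represents G refl refl shaped _ _ _) (_ , _ , sorted) started =
  estimate-≤-nNow G sorted started , nNow-≤-estimate G (WellShaped⇒≤ G shaped) sorted started

≤-suc[/]* : ∀ m n .{{_ : NonZero n}} → m ≤ suc (m / n) * n
≤-suc[/]* m n = begin
  m                 ≡⟨ m≡m%n+[m/n]*n m n ⟩
  m % n + m / n * n ≤⟨ +-monoˡ-≤ (m / n * n) (<⇒≤ (m%n<n m n)) ⟩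
  n + m / n * n     ∎
  where open ≤-Reasoning

*-suc[/]-≤ : ∀ m n .{{_ : NonZero n}} → n * suc (m / n) ≤ n + m
*-suc[/]-≤ m n = begin
  n * suc (m / n) ≡⟨ *-suc n (m / n) ⟩
  n + n * (m / n) ≡⟨ cong (_+_ n) (*-comm n (m / n)) ⟩
  n + m / n * n   ≤⟨ +-monoʳ-≤ n (m/n*n≤m m n) ⟩
  n + m           ∎
  where open ≤-Reasoning

error-scaling : ∀ {p q k e n} → q ≤ k * p → k * e ≤ n → e * q ≤ p * n
error-scaling {p} {q} {k} {e} {n} q≤kp ke≤n = begin
  e * q       ≤⟨ *-monoʳ-≤ e q≤kp ⟩
  e * (k * p) ≡⟨ rearrange e k p ⟩
  p * (k * e) ≤⟨ *-monoʳ-≤ p ke≤n ⟩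
  p * n       ∎
  where
  open ≤-Reasoning
  rearrange : ∀ e k p → e * (k * p) ≡ p * (k * e)
  rearrange = solve-∀

space-scaling : ∀ {p q k} → p ≤ q → p * k ≤ q + q → p * suc ((k + k) + (k + k)) ≤ 9 * q
space-scaling {p} {q} {k} p≤q pk≤2q = begin
  p * suc ((k + k) + (k + k))                         ≡⟨ expand p k ⟩
  p + ((p * k + p * k) + (p * k + p * k))             ≤⟨ +-mono-≤ p≤q (+-mono-≤ 2pk≤4q 2pk≤4q) ⟩
  q + (((q + q) + (q + q)) + ((q + q) + (q + q)))     ≡⟨ collect q ⟩
  9 * q                                               ∎
  where
  open ≤-Reasoning
  2pk≤4q : p * k + p * k ≤ (q + q) + (q + q)
  2pk≤4q = +-mono-≤ pk≤2q pk≤2q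
  expand : ∀ p k → p * suc ((k + k) + (k + k)) ≡ p + ((p * k + p * k) + (p * k + p * k))
  expand = solve-∀
  collect : ∀ q → q + (((q + q) + (q + q)) + ((q + q) + (q + q))) ≡ 9 * q
  collect = solve-∀

Guarantees : (C c : ℕ) → ℚ → StreamAlg → List Item → List Word → Set
Guarantees C c ε A xs memory =
  All (ValidWord c xs) memory ×
  ε ℚ.* ℕtoℚ (length memory) ℚ.≤ ℕtoℚ C ×
  ((t : ℕ) → All (λ x → S x ≤ t) xs →
    query A memory t ≤ nNow t xs ×
    ℕtoℚ (nNow t xs) ℚ.≤ ℕtoℚ (query A memory t) ℚ.+ ε ℚ.* ℕtoℚ (length xs))

module PositiveFraction (p-1 d-1 : ℕ) .(coprime : Coprime (suc p-1) (suc d-1)) where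
  open Fraction (suc p-1) d-1 coprime

  guarantees : frac ℚ.≤ ½ → ∀ xs → ConsistentStream xs →
               Guarantees 9 1 frac (expirationCounter frac) xs (run (expirationCounter frac) xs)
  guarantees ε≤½ xs consistent =
    subst (Guarantees 9 1 frac (expirationCounter frac) xs)
      (sym (run-wordAlgorithm sketchEncoding emptySketch (insert k) estimateActive xs))
      (encodeSketch-valid (s≤s z≤n) R , space , accurate)
    where
    p q k : ℕ
    p = suc p-1
    q = suc d-1
    k = suc (q / p)
    σ : Sketch
    σ = foldl (insert k) emptySketch xs
    R : Represents k σ xs
    R = foldl-insert-represents (s≤s z≤n) xs (emptySketch-represents k)
    p≤q : p ≤ q
    p≤q = ≤-trans (m≤m*n p 2) (frac-≤-½ ε≤½)
    space : frac ℚ.* ℕtoℚ (length (encodeSketch σ)) ℚ.≤ ℕtoℚ 9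
    space = frac-*-ℕtoℚ-≤ (length (encodeSketch σ)) 9
      (≤-trans (*-monoʳ-≤ p (length-encodeSketch R))
               (space-scaling p≤q (≤-trans (*-suc[/]-≤ q p) (+-monoˡ-≤ q p≤q))))
    error≤εn : (width σ ∸ 1) * q ≤ p * length xs
    error≤εn = error-scaling {p} {q} {k} (≤-suc[/]* q p) (Represents.width-bound R)
    accurate : (t : ℕ) → All (λ x → S x ≤ t) xs →
               query (expirationCounter frac) (encodeSketch σ) t ≤ nNow t xs ×
               ℕtoℚ (nNow t xs) ℚ.≤
                 ℕtoℚ (query (expirationCounter frac) (encodeSketch σ) t) ℚ.+ frac ℚ.* ℕtoℚ (length xs)
    accurate t started with estimate-accurate R consistent started
    ... | lower , upper =
      subst (λ e → e ≤ nNow t xs × ℕtoℚ (nNow t xs) ℚ.≤ ℕtoℚ e ℚ.+ frac ℚ.* ℕtoℚ (length xs))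
        (sym (query-wordAlgorithm sketchEncoding emptySketch (insert k) estimateActive σ t))
        (lower , ℕtoℚ-≤-+-frac-* (nNow t xs) (estimateActive σ t) (width σ ∸ 1) (length xs) upper error≤εn)

expirationCounter-guarantees : ∀ ε → 0ℚ ℚ.< ε → ε ℚ.≤ ½ → ∀ xs → ConsistentStream xs →
                               Guarantees 9 1 ε (expirationCounter ε) xs (run (expirationCounter ε) xs)
expirationCounter-guarantees (mkℚ (+ zero)      _   _)       (ℚ.*<* (ℤ.+<+ ()))
expirationCounter-guarantees (mkℚ ℤ.-[1+ _ ]    _   _)       (ℚ.*<* ())
expirationCounter-guarantees (mkℚ (+ suc p-1)   d-1 coprime) _ = PositiveFraction.guarantees p-1 d-1 coprime

theorem5p1 :
    Σ ℕ λ C → Σ ℕ λ c → Σ (ℚ → StreamAlg) λ alg →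
      (ε : ℚ) → 0ℚ ℚ.< ε → ε ℚ.≤ ½ →
      (xs : List Item) → ConsistentStream xs →
        All (ValidWord c xs) (run (alg ε) xs) ×
        ε ℚ.* ℕtoℚ (length (run (alg ε) xs)) ℚ.≤ ℕtoℚ C ×
        ((t : ℕ) → All (λ x → S x ≤ t) xs →
          query (alg ε) (run (alg ε) xs) t ≤ nNow t xs ×
          ℕtoℚ (nNow t xs) ℚ.≤ ℕtoℚ (query (alg ε) (run (alg ε) xs) t) ℚ.+ ε ℚ.* ℕtoℚ (length xs))
theorem5p1 = 9 , 1 , expirationCounter , expirationCounter-guarantees
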